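{- Let $m,n\in\mathbb{N}$. If $T\in\mathscr{S}_m'(n)$, then $T^2\le m(n-1)+1$.
   Context: $\mathbb{N}$ denotes the positive integers. For $m,n\in\mathbb{N}$, $\mathscr{S}_m(n)$ is the set of all $T\in\mathbb{Z}$ for which there exist $x_1,\ldots,x_m\in\mathbb{Z}$ with $x_1+\cdots+x_m=T$ and $x_1^2+\cdots+x_m^2=n$, and $\mathscr{S}_m'(n)=\{T\in\mathscr{S}_m(n): T^2<mn\}$. -}

module Defs where

open import Data.Nat using (ℕ; suc; NonZero)
open import Data.Fin using (Fin) renaming (zero to fzero; suc to fsuc)
open import Data.Integer using (ℤ; _+_; _*_; _-_; +_; _<_)
open import Data.Product using (Σ; _×_)
open import Relation.Binary.PropositionalEquality using (_≡_)

sumℤ : (m : ℕ) → (Fin m → ℤ) → ℤ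
sumℤ Data.Nat.zero x = + 0
sumℤ (suc m) x = x fzero + sumℤ m (λ i → x (fsuc i))

inS : (m n : ℕ) → ℤ → Set
inS m n T = Σ (Fin m → ℤ) λ x →
  (sumℤ m x ≡ T) × (sumℤ m (λ i → x i * x i) ≡ + n)

inS' : (m n : ℕ) → ℤ → Set
inS' m n T = inS m n T × (T * T < + m * + n)

module Submission where

-- Proof idea.  Write T = a·m + r with a = ⌊T/m⌋ and 0 ≤ r < m.  For every
-- integer y the product y(y-1) is nonnegative, so
--
--   e := Σ (xᵢ - a)(xᵢ - a - 1) = n - (2a+1)·T + m·(a² + a)  ≥ 0.
--
-- Eliminating n from this equation gives the key identity
--
--   m·n + r² = T² + m·(e + r),
--
-- so the hypothesis T² < m·n says exactly r² < m·(e + r), and the claim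
-- T² ≤ m(n-1) + 1 says exactly m + r² ≤ m·(e + r) + 1.  The latter is a
-- statement about natural numbers: if e ≥ 1 it follows from r ≤ m, and if
-- e = 0 then 0 < r < m and m·r + 1 - m - r² = (r-1)(m-r-1) ≥ 0.

open import Defs
open import Data.Nat using (ℕ; NonZero)
open import Data.Integer using (ℤ; _+_; _*_; _-_; +_; _≤_)
open import Data.Integer using (-_; _<_; -[1+_]; ∣_∣; 0ℤ; 1ℤ; +≤+)
import Data.Nat as ℕ
import Data.Nat.Properties as ℕ
open import Data.Nat.Tactic.RingSolver as ℕ-Solver using ()
open import Data.Integer.Properties
open import Data.Integer.DivMod using (_/_; _%_; a≡a%n+[a/n]*n; n%d<d)
open import Data.Integer.Tactic.RingSolver using (solve-∀)
open import Data.Fin using (Fin) renaming (zero to fzero; suc to fsuc)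
open import Data.Product using (_,_)
open import Function using (_∘_)
open import Relation.Binary.PropositionalEquality
open import Relation.Nullary using (contradiction)

gap-bound : ∀ M e r → r ℕ.< M → r ℕ.* r ℕ.< M ℕ.* (e ℕ.+ r)
          → M ℕ.+ r ℕ.* r ℕ.≤ M ℕ.* (e ℕ.+ r) ℕ.+ 1
gap-bound M (ℕ.suc e) r r<M _ = begin
  M ℕ.+ r ℕ.* r         ≤⟨ ℕ.+-monoʳ-≤ M (ℕ.*-monoˡ-≤ r (ℕ.<⇒≤ r<M)) ⟩
  M ℕ.+ M ℕ.* r         ≡⟨ ℕ.*-suc M r ⟨
  M ℕ.* ℕ.suc r         ≤⟨ ℕ.*-monoʳ-≤ M (ℕ.s≤s (ℕ.m≤n+m r e)) ⟩
  M ℕ.* (ℕ.suc e ℕ.+ r) ≤⟨ ℕ.m≤m+n _ 1 ⟩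
  M ℕ.* (ℕ.suc e ℕ.+ r) ℕ.+ 1 ∎
  where open ℕ.≤-Reasoning
gap-bound M 0 0 _ 0<M*0 = contradiction (subst (0 ℕ.<_) (ℕ.*-zeroʳ M) 0<M*0) ℕ.n≮0
gap-bound M 0 (ℕ.suc r) r<M _ with ℕ.m≤n⇒∃[o]m+o≡n r<M
... | d , refl = subst (ℕ.suc (ℕ.suc r ℕ.+ d) ℕ.+ ℕ.suc r ℕ.* ℕ.suc r ℕ.≤_)
                       (excess-is-product r d) (ℕ.m≤m+n _ _)
  where
  -- with M = r + 2 + d this is  M + (r+1)² + r·d = M·(r+1) + 1
  excess-is-product : ∀ r d →
    ℕ.suc (ℕ.suc r ℕ.+ d) ℕ.+ ℕ.suc r ℕ.* ℕ.suc r ℕ.+ r ℕ.* d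
      ≡ ℕ.suc (ℕ.suc r ℕ.+ d) ℕ.* (0 ℕ.+ ℕ.suc r) ℕ.+ 1
  excess-is-product = ℕ-Solver.solve-∀

-- The product of two consecutive integers y(y-1) = y² - y is nonnegative:
-- for y ≥ 1 because y ≤ y², and for y < 0 it computes to a natural number.
consecutive-product-nonneg : ∀ y → 0ℤ ≤ y * y - y
consecutive-product-nonneg (+ 0)          = ≤-refl
consecutive-product-nonneg (+ (ℕ.suc j)) =
  subst (0ℤ ≤_) (sym (⊖-≥ (ℕ.m≤m*n (ℕ.suc j) (ℕ.suc j)))) (+≤+ ℕ.z≤n)
consecutive-product-nonneg -[1+ k ]      = +≤+ ℕ.z≤n

sumℤ-nonneg : ∀ m (f : Fin m → ℤ) → (∀ i → 0ℤ ≤ f i) → 0ℤ ≤ sumℤ m f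
sumℤ-nonneg ℕ.zero    f f≥0 = ≤-refl
sumℤ-nonneg (ℕ.suc m) f f≥0 = +-mono-≤ (f≥0 fzero) (sumℤ-nonneg m (f ∘ fsuc) (f≥0 ∘ fsuc))

sumℤ-shifted-consecutive : ∀ m (x : Fin m → ℤ) a →
  sumℤ m (λ i → (x i - a) * (x i - a) - (x i - a))
    ≡ sumℤ m (λ i → x i * x i) - (a + a + 1ℤ) * sumℤ m x + + m * (a * a + a)
sumℤ-shifted-consecutive ℕ.zero    x a = expand-empty a
  where
  expand-empty : ∀ a → 0ℤ ≡ 0ℤ - (a + a + 1ℤ) * 0ℤ + 0ℤ * (a * a + a)
  expand-empty = solve-∀
sumℤ-shifted-consecutive (ℕ.suc m) x a = begin
  head + sumℤ m (λ i → (x (fsuc i) - a) * (x (fsuc i) - a) - (x (fsuc i) - a))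
    ≡⟨ cong (_+_ head) (sumℤ-shifted-consecutive m (x ∘ fsuc) a) ⟩
  head + (squares - (a + a + 1ℤ) * total + + m * (a * a + a))
    ≡⟨ expand-step x₀ squares total a (+ m) ⟩
  (x₀ * x₀ + squares) - (a + a + 1ℤ) * (x₀ + total) + (1ℤ + + m) * (a * a + a) ∎
  where
  open ≡-Reasoning
  x₀ = x fzero
  head = (x₀ - a) * (x₀ - a) - (x₀ - a)
  squares = sumℤ m (λ i → x (fsuc i) * x (fsuc i))
  total = sumℤ m (x ∘ fsuc)
  expand-step : ∀ x₀ s₂ s₁ a m →
    (x₀ - a) * (x₀ - a) - (x₀ - a) + (s₂ - (a + a + 1ℤ) * s₁ + m * (a * a + a))
      ≡ (x₀ * x₀ + s₂) - (a + a + 1ℤ) * (x₀ + s₁) + (1ℤ + m) * (a * a + a)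
  expand-step = solve-∀

gap-boundℤ : ∀ M e r → r ℕ.< M → + r * + r < + M * (+ e + + r)
           → + M + + r * + r ≤ + M * (+ e + + r) + 1ℤ
gap-boundℤ M e r r<M r²<M[e+r] =
  subst₂ _≤_ cast-left (trans (pos-+ (M ℕ.* (e ℕ.+ r)) 1) (cong (_+ 1ℤ) cast-right))
    (+≤+ (gap-bound M e r r<M r²<M[e+r]ℕ))
  where
  cast-right : + (M ℕ.* (e ℕ.+ r)) ≡ + M * (+ e + + r)
  cast-right = trans (pos-* M (e ℕ.+ r)) (cong (+ M *_) (pos-+ e r))
  cast-left : + (M ℕ.+ r ℕ.* r) ≡ + M + + r * + r
  cast-left = trans (pos-+ M (r ℕ.* r)) (cong (_+_ (+ M)) (pos-* r r))
  r²<M[e+r]ℕ : r ℕ.* r ℕ.< M ℕ.* (e ℕ.+ r)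
  r²<M[e+r]ℕ = drop‿+<+ (subst₂ _<_ (sym (pos-* r r)) (sym cast-right) r²<M[e+r])

+-cancelˡ-< : ∀ t {u v} → t + u < t + v → u < v
+-cancelˡ-< t {u} {v} t+u<t+v =
  subst₂ _<_ (cancel t u) (cancel t v) (+-monoʳ-< (- t) t+u<t+v)
  where
  cancel : ∀ t u → - t + (t + u) ≡ u
  cancel = solve-∀

+-cancelʳ-≤ : ∀ c {a b} → a + c ≤ b + c → a ≤ b
+-cancelʳ-≤ c {a} {b} a+c≤b+c =
  subst₂ _≤_ (cancel a c) (cancel b c) (+-monoˡ-≤ (- c) a+c≤b+c)
  where
  cancel : ∀ a c → a + c - c ≡ a
  cancel = solve-∀

division-identity : ∀ M n a r →
  M * n + r * r ≡ (r + a * M) * (r + a * M)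
                  + M * ((n - (a + a + 1ℤ) * (r + a * M) + M * (a * a + a)) + r)
division-identity = solve-∀

excess-positive : ∀ {s t u v} → s + u ≡ t + v → t < s → u < v
excess-positive {s} {t} {u} s+u≡t+v t<s =
  +-cancelˡ-< t (subst (t + u <_) s+u≡t+v (+-monoˡ-< u t<s))

square-bound : ∀ M n t u v → M * n + u ≡ t + v → M + u ≤ v + 1ℤ
             → t ≤ M * (n - 1ℤ) + 1ℤ
square-bound M n t u v Mn+u≡t+v M+u≤v+1 = +-cancelʳ-≤ (M + u) (begin
  t + (M + u)                 ≤⟨ +-monoʳ-≤ t M+u≤v+1 ⟩
  t + (v + 1ℤ)                ≡⟨ +-assoc t v 1ℤ ⟨
  t + v + 1ℤ                  ≡⟨ cong (_+ 1ℤ) Mn+u≡t+v ⟨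
  M * n + u + 1ℤ              ≡⟨ regroup M n u ⟩
  M * (n - 1ℤ) + 1ℤ + (M + u) ∎)
  where
  open ≤-Reasoning
  regroup : ∀ M n u → M * n + u + 1ℤ ≡ M * (n - 1ℤ) + 1ℤ + (M + u)
  regroup = solve-∀

proposition4p3 : (m n : ℕ) → .{{_ : NonZero m}} → .{{_ : NonZero n}} → (T : ℤ) → inS' m n T → T * T ≤ + m * (+ n - + 1) + + 1
proposition4p3 m n T ((x , Σx≡T , Σx²≡n) , T²<mn) =
  square-bound (+ m) (+ n) (T * T) (+ r * + r) (+ m * (+ e + + r)) key
    (gap-boundℤ m e r (n%d<d T (+ m)) (excess-positive key T²<mn))
  where
  a = T / + m
  r = T % + m
  -- excess = Σ (xᵢ - a)(xᵢ - a - 1) ≥ 0, so it is a natural number e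
  excess = + n - (a + a + 1ℤ) * T + + m * (a * a + a)
  excess≥0 : 0ℤ ≤ excess
  excess≥0 = subst₂ (λ s₂ s₁ → 0ℤ ≤ s₂ - (a + a + 1ℤ) * s₁ + + m * (a * a + a)) Σx²≡n Σx≡T
    (subst (0ℤ ≤_) (sumℤ-shifted-consecutive m x a)
      (sumℤ-nonneg m _ (λ i → consecutive-product-nonneg (x i - a))))
  e = ∣ excess ∣
  key : + m * + n + + r * + r ≡ T * T + + m * (+ e + + r)
  key = begin
    + m * + n + + r * + r
      ≡⟨ division-identity (+ m) (+ n) a (+ r) ⟩
    (+ r + a * + m) * (+ r + a * + m)
      + + m * ((+ n - (a + a + 1ℤ) * (+ r + a * + m) + + m * (a * a + a)) + + r)
      ≡⟨ cong (λ t → t * t + + m * ((+ n - (a + a + 1ℤ) * t + + m * (a * a + a)) + + r))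
              (a≡a%n+[a/n]*n T (+ m)) ⟨
    T * T + + m * (excess + + r)
      ≡⟨ cong (λ z → T * T + + m * (z + + r)) (0≤i⇒+∣i∣≡i excess≥0) ⟨
    T * T + + m * (+ e + + r) ∎
    where open ≡-Reasoning
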